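{- Let $M$ be a simple matroid of rank $r$. If $M$ is modular, then the opposite lattice $\mathcal{L}(M)^{op}$ is isomorphic (as a poset) to the extension lattice $\mathcal{E}(M)$ of $M$.
   Context: All matroids are finite and nonempty. $\mathcal{L}(M)$ is the lattice of flats of $M$ ordered by inclusion and $\mathcal{L}(M)^{op}$ the same set with reversed order; $\mathcal{H}(M)$ is the set of hyperplanes of $M$. $M$ is modular if $r(X)+r(Y)=r(X\wedge Y)+r(X\vee Y)$ for all flats $X,Y$. A linear subclass of $M$ is a subset $\mathcal{H}\subseteq\mathcal{H}(M)$ such that whenever $H_1,H_2\in\mathcal{H}$ with $r(H_1\cap H_2)=r(M)-2$ and $H_3$ is a hyperplane of $M$ containing $H_1\cap H_2$, then $H_3\in\mathcal{H}$. The extension lattice $\mathcal{E}(M)$ is the set of all linear subclasses of $M$ ordered by inclusion. -}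

module Defs where

open import Data.Nat using (ℕ; _+_; _≤_; _<_; _≡ᵇ_)
open import Data.Bool using (Bool; true; false; if_then_else_)
open import Data.Fin using (Fin)
open import Data.Fin.Subset using (Subset; _∪_; _∩_; _⊆_; _∉_; ⁅_⁆; ∣_∣; ⊤; inside; outside)
open import Data.Vec using (tabulate)
open import Data.Product using (Σ; _×_; _,_; proj₁; ∃)
open import Relation.Binary.PropositionalEquality using (_≡_; _≢_)
open import Function.Bundles using (_⇔_)

record Matroid (n : ℕ) : Set where
  field
    rk        : Subset n → ℕ
    rk-bound  : ∀ X → rk X ≤ ∣ X ∣
    rk-mono   : ∀ X Y → X ⊆ Y → rk X ≤ rk Y
    rk-submod : ∀ X Y → rk (X ∪ Y) + rk (X ∩ Y) ≤ rk X + rk Y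

module _ {n : ℕ} (M : Matroid n) where
  open Matroid M

  rank : ℕ
  rank = rk ⊤

  IsSimple : Set
  IsSimple = (∀ x → rk ⁅ x ⁆ ≡ 1) × (∀ x y → x ≢ y → rk (⁅ x ⁆ ∪ ⁅ y ⁆) ≡ 2)

  cl : Subset n → Subset n
  cl X = tabulate (λ x → if rk (X ∪ ⁅ x ⁆) ≡ᵇ rk X then inside else outside)

  IsFlat : Subset n → Set
  IsFlat X = ∀ x → x ∉ X → rk X < rk (X ∪ ⁅ x ⁆)

  Flat : Set
  Flat = Σ (Subset n) IsFlat

  _∧F_ : Subset n → Subset n → Subset n
  X ∧F Y = X ∩ Y

  _∨F_ : Subset n → Subset n → Subset n
  X ∨F Y = cl (X ∪ Y)

  IsModular : Set
  IsModular = ∀ X Y → IsFlat X → IsFlat Y →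
              rk X + rk Y ≡ rk (X ∧F Y) + rk (X ∨F Y)

  IsHyperplane : Subset n → Set
  IsHyperplane H = IsFlat H × rk H + 1 ≡ rank

  HypClass : Set
  HypClass = Σ (Subset n → Bool) λ 𝓗 → ∀ H → 𝓗 H ≡ true → IsHyperplane H

  IsLinearSubclass : HypClass → Set
  IsLinearSubclass (𝓗 , _) =
    ∀ H₁ H₂ H₃ → 𝓗 H₁ ≡ true → 𝓗 H₂ ≡ true →
    rk (H₁ ∩ H₂) + 2 ≡ rank →
    IsHyperplane H₃ → (H₁ ∩ H₂) ⊆ H₃ → 𝓗 H₃ ≡ true

  -- elements of the extension lattice E(M)
  LinSub : Set
  LinSub = Σ HypClass IsLinearSubclass

  _⊑_ : LinSub → LinSub → Set
  ((𝓗 , _) , _) ⊑ ((𝓗' , _) , _) = ∀ H → 𝓗 H ≡ true → 𝓗' H ≡ true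

  _≈L_ : LinSub → LinSub → Set
  A ≈L B = (A ⊑ B) × (B ⊑ A)

  -- L(M)^op ≅ E(M) as posets: an order-embedding (for the reversed order
  -- on flats) that is surjective onto E(M)
  OpIsoToExt : Set
  OpIsoToExt =
    Σ (Flat → LinSub) λ f →
      (∀ (X Y : Flat) → (proj₁ X ⊆ proj₁ Y) ⇔ (f Y ⊑ f X)) ×
      (∀ (𝓗 : LinSub) → ∃ λ (X : Flat) → f X ≈L 𝓗)

-- A flat X corresponds to the class of hyperplanes containing it. This class is a linear
-- subclass, and the correspondence reverses inclusion in both directions because every flat
-- is the intersection of the hyperplanes containing it. For surjectivity onto a linear
-- subclass 𝓗, start from the ground set and repeatedly cut the current flat X by a member H′
-- of 𝓗 not containing it, keeping the invariant that every hyperplane above X lies in 𝓗.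
-- Modularity preserves the invariant: if a hyperplane H contains X ∩ H′, then
-- K = X ∨ (H′ ∩ H) is a hyperplane above X, hence in 𝓗, and K ∩ H′ = H′ ∩ H is a coline
-- contained in H, so H ∈ 𝓗. Once every member of 𝓗 contains X, 𝓗 is exactly the class of
-- hyperplanes above X.
module Submission where

open import Defs
open import Data.Nat using (ℕ; zero; suc; _+_; _≤_; _<_; _≡ᵇ_; _≟_; _<?_)
open import Data.Nat.Properties
open import Data.Bool using (Bool; true; false; if_then_else_)
open import Data.Bool.Properties using (T-≡)
import Data.Bool.Properties as Bool
open import Data.Fin using (Fin)
open import Data.Fin.Subset
open import Data.Fin.Subset.Properties
open import Data.Fin.Properties using (all?; any?)
open import Data.Vec using (lookup)
open import Data.Vec.Properties using (lookup∘tabulate; []=⇒lookup; lookup⇒[]=)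
open import Data.List using (List; []; _∷_; map; filter; allFin)
open import Data.List.Relation.Unary.All as All using (All; []; _∷_)
open import Data.List.Relation.Unary.All.Properties using (all-filter)
open import Data.List.Relation.Unary.Any using (here; there)
import Data.List.Membership.Propositional as List
open import Data.List.Membership.Propositional.Properties using (∈-allFin; ∈-filter⁺)
open import Data.Product using (_×_; _,_; proj₁; proj₂; ∃)
open import Data.Sum using ([_,_])
open import Relation.Nullary using (¬_; Dec; yes; no; contradiction)
open import Relation.Nullary.Decidable
  using (_×-dec_; _→-dec_; ¬?; isYes; toWitness; fromWitness; decidable-stable)
open import Relation.Binary.PropositionalEquality hiding ([_])
open import Function using (id)
open import Function.Bundles using (_⇔_; mk⇔; Equivalence)

open Equivalence using (to; from)

if-true-false : ∀ b → (if b then true else false) ≡ b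
if-true-false true  = refl
if-true-false false = refl

module _ {n : ℕ} where

  private variable
    p q r : Subset n
    x : Fin n

  ∪-least : p ⊆ r → q ⊆ r → p ∪ q ⊆ r
  ∪-least {p = p} {q = q} p⊆r q⊆r x∈p∪q = [ p⊆r , q⊆r ] (x∈p∪q⁻ p q x∈p∪q)

  ∩-greatest : r ⊆ p → r ⊆ q → r ⊆ p ∩ q
  ∩-greatest r⊆p r⊆q x∈r = x∈p∩q⁺ (r⊆p x∈r , r⊆q x∈r)

  ⁅x⁆⊆ : x ∈ p → ⁅ x ⁆ ⊆ p
  ⁅x⁆⊆ {x = x} x∈p y∈⁅x⁆ = subst (_∈ _) (sym (x∈⁅y⁆⇒x≡y x y∈⁅x⁆)) x∈p

  ⊈⇒∃∉ : ¬ p ⊆ q → ∃ λ x → x ∈ p × x ∉ q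
  ⊈⇒∃∉ {p = p} {q = q} p⊈q with any? (λ x → (x ∈? p) ×-dec ¬? (x ∈? q))
  ... | yes witness = witness
  ... | no  none    =
    contradiction (λ {x} x∈p → decidable-stable (x ∈? q) (λ x∉q → none (x , x∈p , x∉q))) p⊈q

  ∈⇒∈⋃⁅⁆ : ∀ {xs : List (Fin n)} → x List.∈ xs → x ∈ ⋃ (map ⁅_⁆ xs)
  ∈⇒∈⋃⁅⁆ (here refl)                  = p⊆p∪q _ (x∈⁅x⁆ _)
  ∈⇒∈⋃⁅⁆ {xs = y ∷ _} (there x∈ys) = q⊆p∪q ⁅ y ⁆ _ (∈⇒∈⋃⁅⁆ x∈ys)

module _ {n : ℕ} (M : Matroid n) where
  open Matroid M

  private variable
    A B F H H′ X Y : Subset n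
    x y : Fin n

  ⊆⇒rk≤ : A ⊆ B → rk A ≤ rk B
  ⊆⇒rk≤ = rk-mono _ _

  rk-submod-⊆ : A ⊆ X ∪ Y → B ⊆ X ∩ Y → rk A + rk B ≤ rk X + rk Y
  rk-submod-⊆ {X = X} {Y = Y} A⊆ B⊆ =
    ≤-trans (+-mono-≤ (⊆⇒rk≤ A⊆) (⊆⇒rk≤ B⊆)) (rk-submod X Y)

  rk-∪⁅⁆ : ∀ X x → rk (X ∪ ⁅ x ⁆) ≤ rk X + 1
  rk-∪⁅⁆ X x = begin
    rk (X ∪ ⁅ x ⁆)                  ≤⟨ m≤m+n _ _ ⟩
    rk (X ∪ ⁅ x ⁆) + rk (X ∩ ⁅ x ⁆) ≤⟨ rk-submod X ⁅ x ⁆ ⟩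
    rk X + rk ⁅ x ⁆                 ≤⟨ +-monoʳ-≤ (rk X) (rk-bound ⁅ x ⁆) ⟩
    rk X + ∣ ⁅ x ⁆ ∣                ≡⟨ cong (rk X +_) (∣⁅x⁆∣≡1 x) ⟩
    rk X + 1                        ∎
    where open ≤-Reasoning

  ⊆flat⇒rk<rk∪⁅⁆ : IsFlat M X → x ∉ X → B ⊆ X → rk B < rk (B ∪ ⁅ x ⁆)
  ⊆flat⇒rk<rk∪⁅⁆ {X = X} {x = x} {B = B} X-flat x∉X B⊆X = +-cancelˡ-≤ (rk X) _ _ (begin
    rk X + suc (rk B)      ≡⟨ +-suc (rk X) (rk B) ⟩
    suc (rk X) + rk B      ≤⟨ +-monoˡ-≤ (rk B) (X-flat x x∉X) ⟩
    rk (X ∪ ⁅ x ⁆) + rk B  ≤⟨ rk-submod-⊆ (∪-least (p⊆p∪q _) (λ h → q⊆p∪q X _ (q⊆p∪q B _ h)))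
                                          (∩-greatest B⊆X (p⊆p∪q _)) ⟩
    rk X + rk (B ∪ ⁅ x ⁆)  ∎)
    where open ≤-Reasoning

  ∈cl⇔ : x ∈ cl M X ⇔ rk (X ∪ ⁅ x ⁆) ≡ rk X
  ∈cl⇔ {x = x} {X = X} = mk⇔
    (λ x∈ → ≡ᵇ⇒≡ _ _ (from T-≡ (trans (sym lookup-cl) ([]=⇒lookup x∈))))
    (λ eq → lookup⇒[]= x (cl M X) (trans lookup-cl (to T-≡ (≡⇒≡ᵇ _ _ eq))))
    where
    lookup-cl : lookup (cl M X) x ≡ (rk (X ∪ ⁅ x ⁆) ≡ᵇ rk X)
    lookup-cl = trans (lookup∘tabulate _ x) (if-true-false _)

  ⊆-cl : X ⊆ cl M X
  ⊆-cl x∈X = from ∈cl⇔ (≤-antisym (⊆⇒rk≤ (∪-least id (⁅x⁆⊆ x∈X))) (⊆⇒rk≤ (p⊆p∪q _)))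

  rk-∪-⋃⁅⁆ : ∀ X xs → All (λ x → rk (X ∪ ⁅ x ⁆) ≤ rk X) xs → rk (X ∪ ⋃ (map ⁅_⁆ xs)) ≤ rk X
  rk-∪-⋃⁅⁆ X []       []                            = ⊆⇒rk≤ (∪-least id ⊥⊆)
  rk-∪-⋃⁅⁆ X (x ∷ xs) (x-redundant ∷ xs-redundant) = +-cancelʳ-≤ (rk X) _ _ (begin
    rk (X ∪ (⁅ x ⁆ ∪ U)) + rk X ≤⟨ rk-submod-⊆ (∪-least (λ h → p⊆p∪q _ (p⊆p∪q U h)) x∪U⊆)
                                               (∩-greatest (p⊆p∪q _) (p⊆p∪q _)) ⟩
    rk (X ∪ U) + rk (X ∪ ⁅ x ⁆) ≤⟨ +-mono-≤ (rk-∪-⋃⁅⁆ X xs xs-redundant) x-redundant ⟩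
    rk X + rk X                 ∎)
    where
    open ≤-Reasoning
    U : Subset n
    U = ⋃ (map ⁅_⁆ xs)
    x∪U⊆ : ⁅ x ⁆ ∪ U ⊆ (X ∪ U) ∪ (X ∪ ⁅ x ⁆)
    x∪U⊆ = ∪-least (λ h → q⊆p∪q _ _ (q⊆p∪q X _ h)) (λ h → p⊆p∪q _ (q⊆p∪q X U h))

  rk-cl : ∀ X → rk (cl M X) ≡ rk X
  rk-cl X = ≤-antisym (≤-trans (⊆⇒rk≤ cl⊆) (rk-∪-⋃⁅⁆ X xs xs-redundant)) (⊆⇒rk≤ ⊆-cl)
    where
    xs : List (Fin n)
    xs = filter (_∈? cl M X) (allFin n)
    xs-redundant : All (λ x → rk (X ∪ ⁅ x ⁆) ≤ rk X) xs
    xs-redundant = All.map (λ x∈ → ≤-reflexive (to ∈cl⇔ x∈)) (all-filter (_∈? cl M X) (allFin n))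
    cl⊆ : cl M X ⊆ X ∪ ⋃ (map ⁅_⁆ xs)
    cl⊆ {x} x∈ = q⊆p∪q X _ (∈⇒∈⋃⁅⁆ (∈-filter⁺ (_∈? cl M X) (∈-allFin x) x∈))

  cl-isFlat : ∀ X → IsFlat M (cl M X)
  cl-isFlat X x x∉ = begin-strict
    rk (cl M X)         ≡⟨ rk-cl X ⟩
    rk X                <⟨ ≤∧≢⇒< (⊆⇒rk≤ (p⊆p∪q _)) (λ eq → x∉ (from ∈cl⇔ (sym eq))) ⟩
    rk (X ∪ ⁅ x ⁆)      ≤⟨ ⊆⇒rk≤ (∪-least (λ h → p⊆p∪q _ (⊆-cl h)) (q⊆p∪q _ _)) ⟩
    rk (cl M X ∪ ⁅ x ⁆) ∎
    where open ≤-Reasoning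

  cl-least : X ⊆ F → IsFlat M F → cl M X ⊆ F
  cl-least {F = F} X⊆F F-flat {x} x∈clX = decidable-stable (x ∈? F) λ x∉F →
    <⇒≢ (⊆flat⇒rk<rk∪⁅⁆ F-flat x∉F X⊆F) (sym (to ∈cl⇔ x∈clX))

  flat⊆∧rk≤⇒⊇ : IsFlat M A → A ⊆ B → rk B ≤ rk A → B ⊆ A
  flat⊆∧rk≤⇒⊇ {A = A} A-flat A⊆B rkB≤rkA {x} x∈B = decidable-stable (x ∈? A) λ x∉A →
    <⇒≱ (A-flat x x∉A) (≤-trans (⊆⇒rk≤ (∪-least A⊆B (⁅x⁆⊆ x∈B))) rkB≤rkA)

  ⊤-isFlat : IsFlat M ⊤
  ⊤-isFlat _ x∉⊤ = contradiction ∈⊤ x∉⊤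

  ∩-isFlat : IsFlat M X → IsFlat M Y → IsFlat M (X ∩ Y)
  ∩-isFlat {X = X} {Y = Y} X-flat Y-flat x x∉X∩Y with x ∈? X
  ... | no  x∉X = ⊆flat⇒rk<rk∪⁅⁆ X-flat x∉X (p∩q⊆p X Y)
  ... | yes x∈X = ⊆flat⇒rk<rk∪⁅⁆ Y-flat (λ x∈Y → x∉X∩Y (x∈p∩q⁺ (x∈X , x∈Y))) (p∩q⊆q X Y)

  IsFlat? : ∀ X → Dec (IsFlat M X)
  IsFlat? X = all? λ x → ¬? (x ∈? X) →-dec (rk X <? rk (X ∪ ⁅ x ⁆))

  IsHyperplane? : ∀ H → Dec (IsHyperplane M H)
  IsHyperplane? H = IsFlat? H ×-dec (rk H + 1 ≟ rank M)

  hyperplane-⊆⇒⊇ : IsHyperplane M H → IsHyperplane M H′ → H ⊆ H′ → H′ ⊆ H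
  hyperplane-⊆⇒⊇ (H-flat , rkH+1≡rank) (_ , rkH′+1≡rank) H⊆H′ =
    flat⊆∧rk≤⇒⊇ H-flat H⊆H′ (≤-reflexive (+-cancelʳ-≡ 1 _ _ (trans rkH′+1≡rank (sym rkH+1≡rank))))

  hyperplane∪⁅x⁆⊆⇒spanning : IsHyperplane M H → x ∉ H → H ∪ ⁅ x ⁆ ⊆ A → rk A ≡ rank M
  hyperplane∪⁅x⁆⊆⇒spanning {H = H} {x = x} (H-flat , rkH+1≡rank) x∉H H∪x⊆A =
    ≤-antisym (⊆⇒rk≤ ⊆⊤) (begin
      rank M         ≡⟨ sym rkH+1≡rank ⟩
      rk H + 1       ≡⟨ +-comm (rk H) 1 ⟩
      suc (rk H)     ≤⟨ H-flat x x∉H ⟩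
      rk (H ∪ ⁅ x ⁆) ≤⟨ ⊆⇒rk≤ H∪x⊆A ⟩
      rk _           ∎)
    where open ≤-Reasoning

  cl-exchange : IsFlat M F → x ∉ F → x ∈ cl M (F ∪ ⁅ y ⁆) → y ∈ cl M (F ∪ ⁅ x ⁆)
  cl-exchange {F = F} {x = x} {y = y} F-flat x∉F x∈clFy =
    flat⊆∧rk≤⇒⊇ (cl-isFlat _) clFx⊆clFy rk≤ (⊆-cl (q⊆p∪q F _ (x∈⁅x⁆ y)))
    where
    open ≤-Reasoning
    clFx⊆clFy : cl M (F ∪ ⁅ x ⁆) ⊆ cl M (F ∪ ⁅ y ⁆)
    clFx⊆clFy = cl-least (∪-least (λ h → ⊆-cl (p⊆p∪q _ h)) (⁅x⁆⊆ x∈clFy)) (cl-isFlat _)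
    rk≤ : rk (cl M (F ∪ ⁅ y ⁆)) ≤ rk (cl M (F ∪ ⁅ x ⁆))
    rk≤ = begin
      rk (cl M (F ∪ ⁅ y ⁆)) ≡⟨ rk-cl _ ⟩
      rk (F ∪ ⁅ y ⁆)        ≤⟨ rk-∪⁅⁆ F y ⟩
      rk F + 1              ≡⟨ +-comm (rk F) 1 ⟩
      suc (rk F)            ≤⟨ F-flat x x∉F ⟩
      rk (F ∪ ⁅ x ⁆)        ≡⟨ sym (rk-cl _) ⟩
      rk (cl M (F ∪ ⁅ x ⁆)) ∎

  flat-grows-avoiding : IsFlat M F → x ∉ F → rk F + 1 ≢ rank M →
                        ∃ λ F′ → IsFlat M F′ × F ⊆ F′ × x ∉ F′ × rk F < rk F′
  flat-grows-avoiding {F = F} {x = x} F-flat x∉F rkF+1≢rank with ⊤ ⊆? cl M (F ∪ ⁅ x ⁆)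
  ... | yes spanning = contradiction (≤-antisym rkF+1≤rank (begin
          rank M                ≤⟨ ⊆⇒rk≤ spanning ⟩
          rk (cl M (F ∪ ⁅ x ⁆)) ≡⟨ rk-cl _ ⟩
          rk (F ∪ ⁅ x ⁆)        ≤⟨ rk-∪⁅⁆ F x ⟩
          rk F + 1              ∎)) rkF+1≢rank
    where
    open ≤-Reasoning
    rkF+1≤rank : rk F + 1 ≤ rank M
    rkF+1≤rank = ≤-trans (≤-reflexive (+-comm (rk F) 1)) (≤-trans (F-flat x x∉F) (⊆⇒rk≤ ⊆⊤))
  ... | no ⊤⊈clFx with ⊈⇒∃∉ ⊤⊈clFx
  ...   | y , _ , y∉clFx =
    cl M (F ∪ ⁅ y ⁆) , cl-isFlat _ , (λ h → ⊆-cl (p⊆p∪q _ h)) ,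
    (λ x∈clFy → y∉clFx (cl-exchange F-flat x∉F x∈clFy)) ,
    ≤-trans (F-flat y (λ y∈F → y∉clFx (⊆-cl (p⊆p∪q _ y∈F)))) (≤-reflexive (sym (rk-cl _)))

  hyperplane-separates : IsFlat M F → x ∉ F → ∃ λ H → IsHyperplane M H × F ⊆ H × x ∉ H
  hyperplane-separates {x = x} F-flat x∉F = go (rank M) F-flat x∉F (m≤m+n _ _)
    where
    go : ∀ k {F} → IsFlat M F → x ∉ F → rank M ≤ k + rk F →
         ∃ λ H → IsHyperplane M H × F ⊆ H × x ∉ H
    go k {F} F-flat x∉F rank≤ with rk F + 1 ≟ rank M
    ... | yes rkF+1≡rank = F , (F-flat , rkF+1≡rank) , id , x∉F
    go zero    F-flat x∉F rank≤ | no _ =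
      contradiction (≤-trans (⊆⇒rk≤ ⊆⊤) rank≤) (<⇒≱ (F-flat x x∉F))
    go (suc k) {F} F-flat x∉F rank≤ | no rkF+1≢rank
      with flat-grows-avoiding F-flat x∉F rkF+1≢rank
    ... | F′ , F′-flat , F⊆F′ , x∉F′ , rkF<rkF′ =
      let (H , H-hyp , F′⊆H , x∉H) = go k F′-flat x∉F′ (≤-trans rank≤ (begin
            suc k + rk F   ≡⟨ sym (+-suc k (rk F)) ⟩
            k + suc (rk F) ≤⟨ +-monoʳ-≤ k rkF<rkF′ ⟩
            k + rk F′      ∎))
      in H , H-hyp , (λ h → F′⊆H (F⊆F′ h)) , x∉H
      where open ≤-Reasoning

  above? : Subset n → Subset n → Bool
  above? X H = isYes (IsHyperplane? H ×-dec X ⊆? H)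

  above?⇔ : above? X H ≡ true ⇔ (IsHyperplane M H × X ⊆ H)
  above?⇔ {X = X} {H = H} =
    mk⇔ (λ e → toWitness {a? = H-above?} (from T-≡ e)) (λ w → to T-≡ (fromWitness {a? = H-above?} w))
    where
    H-above? : Dec (IsHyperplane M H × X ⊆ H)
    H-above? = IsHyperplane? H ×-dec X ⊆? H

  hyperplanesAbove : Subset n → LinSub M
  hyperplanesAbove X = (above? X , λ H e → proj₁ (to above?⇔ e)) , linear
    where
    linear : IsLinearSubclass M (above? X , λ H e → proj₁ (to above?⇔ e))
    linear H₁ H₂ H₃ H₁-above H₂-above _ H₃-hyp H₁∩H₂⊆H₃ = from above?⇔ (H₃-hyp , λ x∈X →
      H₁∩H₂⊆H₃ (x∈p∩q⁺ (proj₂ (to above?⇔ H₁-above) x∈X , proj₂ (to above?⇔ H₂-above) x∈X)))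

  ⊆⇔hyperplanesAbove-⊒ : IsFlat M Y → (X ⊆ Y) ⇔ _⊑_ M (hyperplanesAbove Y) (hyperplanesAbove X)
  ⊆⇔hyperplanesAbove-⊒ {Y = Y} {X = X} Y-flat = mk⇔ antitone reflects
    where
    antitone : X ⊆ Y → _⊑_ M (hyperplanesAbove Y) (hyperplanesAbove X)
    antitone X⊆Y H H-above =
      let (H-hyp , Y⊆H) = to above?⇔ H-above in from above?⇔ (H-hyp , λ h → Y⊆H (X⊆Y h))
    reflects : _⊑_ M (hyperplanesAbove Y) (hyperplanesAbove X) → X ⊆ Y
    reflects Y⊒X {x} x∈X = decidable-stable (x ∈? Y) λ x∉Y →
      let (H , H-hyp , Y⊆H , x∉H) = hyperplane-separates Y-flat x∉Y
      in x∉H (proj₂ (to above?⇔ (Y⊒X H (from above?⇔ (H-hyp , Y⊆H)))) x∈X)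

  module Modular (modular : IsModular M) where

    rk-∩-hyperplane : IsFlat M X → IsHyperplane M H → x ∈ X → x ∉ H → rk (X ∩ H) + 1 ≡ rk X
    rk-∩-hyperplane {X = X} {H = H} X-flat H-hyp@(H-flat , rkH+1≡rank) x∈X x∉H =
      +-cancelʳ-≡ (rk H) _ _ (begin
        rk (X ∩ H) + 1 + rk H           ≡⟨ +-assoc (rk (X ∩ H)) 1 (rk H) ⟩
        rk (X ∩ H) + (1 + rk H)         ≡⟨ cong (rk (X ∩ H) +_) (+-comm 1 (rk H)) ⟩
        rk (X ∩ H) + (rk H + 1)         ≡⟨ cong (rk (X ∩ H) +_) rkH+1≡rank ⟩
        rk (X ∩ H) + rank M             ≡⟨ cong (rk (X ∩ H) +_) (sym spanning) ⟩
        rk (X ∩ H) + rk (cl M (X ∪ H))  ≡⟨ sym (modular X H X-flat H-flat) ⟩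
        rk X + rk H                     ∎)
      where
      open ≡-Reasoning
      spanning : rk (cl M (X ∪ H)) ≡ rank M
      spanning = hyperplane∪⁅x⁆⊆⇒spanning H-hyp x∉H
        (∪-least (λ h → ⊆-cl (q⊆p∪q X H h)) (λ h → ⊆-cl (p⊆p∪q H (⁅x⁆⊆ x∈X h))))

    rk-cl-∪ : IsFlat M X → IsFlat M Y → rk (X ∩ Y) + 1 ≡ rk X → rk (cl M (X ∪ Y)) ≡ rk Y + 1
    rk-cl-∪ {X = X} {Y = Y} X-flat Y-flat rkX∩Y+1≡rkX = +-cancelˡ-≡ (rk (X ∩ Y)) _ _ (begin
      rk (X ∩ Y) + rk (cl M (X ∪ Y)) ≡⟨ sym (modular X Y X-flat Y-flat) ⟩
      rk X + rk Y                    ≡⟨ cong (_+ rk Y) (sym rkX∩Y+1≡rkX) ⟩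
      rk (X ∩ Y) + 1 + rk Y          ≡⟨ +-assoc (rk (X ∩ Y)) 1 (rk Y) ⟩
      rk (X ∩ Y) + (1 + rk Y)        ≡⟨ cong (rk (X ∩ Y) +_) (+-comm 1 (rk Y)) ⟩
      rk (X ∩ Y) + (rk Y + 1)        ∎)
      where open ≡-Reasoning

    module _ (L : LinSub M) where
      private
        inL : Subset n → Bool
        inL = proj₁ (proj₁ L)
        inL⇒hyperplane : ∀ H → inL H ≡ true → IsHyperplane M H
        inL⇒hyperplane = proj₂ (proj₁ L)
        linear : IsLinearSubclass M (proj₁ L)
        linear = proj₂ L

      AboveIn : Subset n → Set
      AboveIn X = ∀ H → IsHyperplane M H → X ⊆ H → inL H ≡ true

      ⊤-aboveIn : AboveIn ⊤
      ⊤-aboveIn H (_ , rkH+1≡rank) ⊤⊆H =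
        contradiction (⊆⇒rk≤ ⊤⊆H) (<⇒≱ (≤-reflexive (trans (+-comm 1 (rk H)) rkH+1≡rank)))

      aboveIn-∩ : IsFlat M X → AboveIn X → inL H′ ≡ true → x ∈ X → x ∉ H′ → AboveIn (X ∩ H′)
      aboveIn-∩ {X = X} {H′ = H′} {x = x} X-flat X-above H′∈L x∈X x∉H′ H H-hyp X∩H′⊆H
        with H′ ⊆? H
      ... | yes H′⊆H =
        subst (λ K → inL K ≡ true) (⊆-antisym H′⊆H (hyperplane-⊆⇒⊇ H′-hyp H-hyp H′⊆H)) H′∈L
        where
        H′-hyp : IsHyperplane M H′
        H′-hyp = inL⇒hyperplane H′ H′∈L
      ... | no H′⊈H with ⊈⇒∃∉ H′⊈H
      ...   | y , y∈H′ , y∉H = linear K H′ H K∈L H′∈L rkK∩H′+2≡rank H-hyp K∩H′⊆H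
        where
        H′-hyp : IsHyperplane M H′
        H′-hyp = inL⇒hyperplane H′ H′∈L
        C : Subset n
        C = H′ ∩ H
        C-flat : IsFlat M C
        C-flat = ∩-isFlat (proj₁ H′-hyp) (proj₁ H-hyp)
        X∩C≡X∩H′ : X ∩ C ≡ X ∩ H′
        X∩C≡X∩H′ = ⊆-antisym (∩-greatest (p∩q⊆p X C) (λ h → p∩q⊆p H′ H (p∩q⊆q X C h)))
                             (∩-greatest (p∩q⊆p X H′) (∩-greatest (p∩q⊆q X H′) X∩H′⊆H))
        K : Subset n
        K = cl M (X ∪ C)
        rkK≡rkC+1 : rk K ≡ rk C + 1
        rkK≡rkC+1 = rk-cl-∪ X-flat C-flat
          (trans (cong (λ Z → rk Z + 1) X∩C≡X∩H′) (rk-∩-hyperplane X-flat H′-hyp x∈X x∉H′))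
        K-hyp : IsHyperplane M K
        K-hyp = cl-isFlat _ , trans (cong (_+ 1) rkK≡rkC+1)
          (trans (cong (_+ 1) (rk-∩-hyperplane (proj₁ H′-hyp) H-hyp y∈H′ y∉H)) (proj₂ H′-hyp))
        K∈L : inL K ≡ true
        K∈L = X-above K K-hyp (λ h → ⊆-cl (p⊆p∪q _ h))
        rkK∩H′+1≡rkK : rk (K ∩ H′) + 1 ≡ rk K
        rkK∩H′+1≡rkK = rk-∩-hyperplane (proj₁ K-hyp) H′-hyp (⊆-cl (p⊆p∪q _ x∈X)) x∉H′
        rkK∩H′+2≡rank : rk (K ∩ H′) + 2 ≡ rank M
        rkK∩H′+2≡rank = trans (sym (+-assoc _ 1 1)) (trans (cong (_+ 1) rkK∩H′+1≡rkK) (proj₂ K-hyp))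
        K∩H′⊆H : K ∩ H′ ⊆ H
        K∩H′⊆H h = p∩q⊆q H′ H (flat⊆∧rk≤⇒⊇ C-flat
          (∩-greatest (λ h → ⊆-cl (q⊆p∪q X C h)) (p∩q⊆p H′ H))
          (≤-reflexive (+-cancelʳ-≡ 1 _ _ (trans rkK∩H′+1≡rkK rkK≡rkC+1))) h)

      hyperplanesAbove-≈L : (∀ H → inL H ≡ true → X ⊆ H) → AboveIn X →
                            _≈L_ M (hyperplanesAbove X) L
      hyperplanesAbove-≈L L-above X-above =
        (λ H H-above → let (H-hyp , X⊆H) = to above?⇔ H-above in X-above H H-hyp X⊆H) ,
        (λ H H∈L → from above?⇔ (inL⇒hyperplane H H∈L , L-above H H∈L))

      descend : ∀ k → IsFlat M X → rk X ≡ k → AboveIn X →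
                ∃ λ (Y : Flat M) → _≈L_ M (hyperplanesAbove (proj₁ Y)) L
      descend {X = X} k X-flat rkX≡k X-above
        with anySubset? (λ H → (inL H Bool.≟ true) ×-dec ¬? (X ⊆? H))
      ... | no none = (X , X-flat) , hyperplanesAbove-≈L
            (λ H H∈L → decidable-stable (X ⊆? H) (λ X⊈H → none (H , H∈L , X⊈H))) X-above
      ... | yes (H′ , H′∈L , X⊈H′) with ⊈⇒∃∉ X⊈H′ | k
      ...   | x , x∈X , x∉H′ | zero   = contradiction (trans rkX∩H′+1≡rkX rkX≡k) (m+1+n≢0 _)
        where
        rkX∩H′+1≡rkX : rk (X ∩ H′) + 1 ≡ rk X
        rkX∩H′+1≡rkX = rk-∩-hyperplane X-flat (inL⇒hyperplane H′ H′∈L) x∈X x∉H′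
      ...   | x , x∈X , x∉H′ | suc k′ =
        descend k′ (∩-isFlat X-flat (proj₁ H′-hyp))
          (suc-injective (trans (+-comm 1 _)
            (trans (rk-∩-hyperplane X-flat H′-hyp x∈X x∉H′) rkX≡k)))
          (aboveIn-∩ X-flat X-above H′∈L x∈X x∉H′)
        where
        H′-hyp : IsHyperplane M H′
        H′-hyp = inL⇒hyperplane H′ H′∈L

      represented : ∃ λ (Y : Flat M) → _≈L_ M (hyperplanesAbove (proj₁ Y)) L
      represented = descend (rank M) ⊤-isFlat refl ⊤-aboveIn

lemma4p2 : ∀ {n : ℕ} → 0 < n → (M : Matroid n) →
             IsSimple M → IsModular M → OpIsoToExt M
lemma4p2 _ M _ modular =
  (λ X → hyperplanesAbove M (proj₁ X)) ,
  (λ X Y → ⊆⇔hyperplanesAbove-⊒ M (proj₂ Y)) ,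
  represented
  where open Modular M modular
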